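{- $\mathcal{L}_{AIL}\not\preceq\mathcal{L}_{FH}$: there exists $\psi\in\mathcal{L}_{AIL}$ such that no $\chi\in\mathcal{L}_{FH}$ satisfies, for every epistemic model with awareness $M$ and every world $w$ of $M$, $M,w\vDash_{AIL}\psi$ iff $M,w\vDash_{FH}\chi$.
   Context: Let $\mathcal{P}$ be a countable set of atomic propositions and $\mathcal{G}$ a finite set of agents. $\mathcal{L}_{AIL}$ is generated by $\varphi::= p\mid\neg\varphi\mid\varphi\wedge\varphi\mid A_i\varphi\mid I_i\varphi\mid E_i\varphi\mid[\approx]_i\varphi\mid[\circ^+]_i\varphi$ ($p\in\mathcal{P}$, $i\in\mathcal{G}$); $\mathcal{L}_{FH}$ is generated by $\varphi::= p\mid\neg\varphi\mid\varphi\wedge\varphi\mid A_i\varphi\mid I_i\varphi\mid E_i\varphi$. $At(\varphi)$ is the set of atoms occurring in $\varphi$. An epistemic model with awareness is $M=\langle W,\{\sim_i,\mathscr{A}_i\}_{i\in\mathcal{G}},V\rangle$ where $W\neq\emptyset$, each $\sim_i$ is an equivalence relation on $W$, each $\mathscr{A}_i:W\to 2^{\mathcal{P}}$ satisfies: if $(w,v)\in\sim_i$ then $\mathscr{A}_i(w)=\mathscr{A}_i(v)$, and $V:\mathcal{P}\to 2^W$. The A-equivalence relation $\approx_i$: $(w,v)\in\approx_i$ iff $\mathscr{A}_i(w)=\mathscr{A}_i(v)$ and for every $p\in\mathscr{A}_i(w)$, $w\in V(p)$ iff $v\in V(p)$. $\sim_i\circ\approx_i=\{(w,u)\mid\exists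 t\,((w,t)\in\approx_i,(t,u)\in\sim_i)\}$, $(\sim_i\circ\approx_i)^+$ its transitive closure. Semantics $\vDash_{AIL}$: $M,w\vDash p$ iff $w\in V(p)$; Booleans as usual; $M,w\vDash A_i\varphi$ iff $At(\varphi)\subseteq\mathscr{A}_i(w)$; $M,w\vDash I_i\varphi$ iff $\varphi$ holds at all $v$ with $(w,v)\in\sim_i$; $M,w\vDash[\approx]_i\varphi$ iff $\varphi$ holds at all $v$ with $(w,v)\in\approx_i$; $M,w\vDash[\circ^+]_i\varphi$ iff $\varphi$ holds at all $v$ with $(w,v)\in(\sim_i\circ\approx_i)^+$; $M,w\vDash E_i\varphi$ iff $M,w\vDash A_i\varphi$ and $M,w\vDash[\circ^+]_i\varphi$. Semantics $\vDash_{FH}$ for $\mathcal{L}_{FH}$ on the same models: same clauses for atoms, Booleans, $A_i$, $I_i$, but $M,w\vDash_{FH}E_i\varphi$ iff $M,w\vDash_{FH}A_i\varphi$ and $M,w\vDash_{FH}I_i\varphi$. -}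

module Defs where

open import Data.Nat using (ℕ)
open import Data.Fin using (Fin)
open import Data.List using (List; []; _++_; [_])
open import Data.List.Relation.Unary.All using (All)
open import Data.Product using (_×_; Σ)
open import Relation.Nullary using (¬_)
open import Relation.Binary.Core using (Rel)
open import Relation.Binary.Structures using (IsEquivalence)
open import Relation.Binary.Construct.Closure.Transitive using (TransClosure)

Atom : Set
Atom = ℕ

_⇔_ : Set → Set → Set
P ⇔ Q = (P → Q) × (Q → P)

data FormAIL (g : ℕ) : Set where
  atom : Atom → FormAIL g
  ¬'_  : FormAIL g → FormAIL g
  _∧'_ : FormAIL g → FormAIL g → FormAIL g
  A    : Fin g → FormAIL g → FormAIL g
  I    : Fin g → FormAIL g → FormAIL g
  E    : Fin g → FormAIL g → FormAIL g
  [≈]  : Fin g → FormAIL g → FormAIL g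
  [∘⁺] : Fin g → FormAIL g → FormAIL g

data FormFH (g : ℕ) : Set where
  atom : Atom → FormFH g
  ¬'_  : FormFH g → FormFH g
  _∧'_ : FormFH g → FormFH g → FormFH g
  A    : Fin g → FormFH g → FormFH g
  I    : Fin g → FormFH g → FormFH g
  E    : Fin g → FormFH g → FormFH g

AtAIL : ∀ {g} → FormAIL g → List Atom
AtAIL (atom p) = [ p ]
AtAIL (¬' φ) = AtAIL φ
AtAIL (φ ∧' ψ) = AtAIL φ ++ AtAIL ψ
AtAIL (A i φ) = AtAIL φ
AtAIL (I i φ) = AtAIL φ
AtAIL (E i φ) = AtAIL φ
AtAIL ([≈] i φ) = AtAIL φ
AtAIL ([∘⁺] i φ) = AtAIL φ

AtFH : ∀ {g} → FormFH g → List Atom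
AtFH (atom p) = [ p ]
AtFH (¬' φ) = AtFH φ
AtFH (φ ∧' ψ) = AtFH φ ++ AtFH ψ
AtFH (A i φ) = AtFH φ
AtFH (I i φ) = AtFH φ
AtFH (E i φ) = AtFH φ

-- Epistemic model with awareness.  Subsets of Atom / W are predicates.
record Model (g : ℕ) : Set₁ where
  field
    W       : Set
    nonempty : W
    ∼       : Fin g → Rel W _
    ∼-equiv : ∀ i → IsEquivalence (∼ i)
    𝒜       : Fin g → W → Atom → Set
    𝒜-∼     : ∀ i w v → ∼ i w v → ∀ p → 𝒜 i w p ⇔ 𝒜 i v p
    V       : Atom → W → Set

  ≈ : Fin g → Rel W _
  ≈ i w v = (∀ p → 𝒜 i w p ⇔ 𝒜 i v p) × (∀ p → 𝒜 i w p → (V p w ⇔ V p v))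

  -- ∼_i ∘ ≈_i : first ≈_i then ∼_i
  ∼∘≈ : Fin g → Rel W _
  ∼∘≈ i w u = Σ W (λ t → ≈ i w t × ∼ i t u)

  ∘⁺ : Fin g → Rel W _
  ∘⁺ i = TransClosure (∼∘≈ i)

open Model public

_,_⊨AIL_ : ∀ {g} (M : Model g) → W M → FormAIL g → Set
M , w ⊨AIL atom p = V M p w
M , w ⊨AIL (¬' φ) = ¬ (M , w ⊨AIL φ)
M , w ⊨AIL (φ ∧' ψ) = (M , w ⊨AIL φ) × (M , w ⊨AIL ψ)
M , w ⊨AIL A i φ = All (𝒜 M i w) (AtAIL φ)
M , w ⊨AIL I i φ = ∀ v → ∼ M i w v → M , v ⊨AIL φ
M , w ⊨AIL E i φ = All (𝒜 M i w) (AtAIL φ) × (∀ v → ∘⁺ M i w v → M , v ⊨AIL φ)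
M , w ⊨AIL [≈] i φ = ∀ v → ≈ M i w v → M , v ⊨AIL φ
M , w ⊨AIL [∘⁺] i φ = ∀ v → ∘⁺ M i w v → M , v ⊨AIL φ

_,_⊨FH_ : ∀ {g} (M : Model g) → W M → FormFH g → Set
M , w ⊨FH atom p = V M p w
M , w ⊨FH (¬' φ) = ¬ (M , w ⊨FH φ)
M , w ⊨FH (φ ∧' ψ) = (M , w ⊨FH φ) × (M , w ⊨FH ψ)
M , w ⊨FH A i φ = All (𝒜 M i w) (AtFH φ)
M , w ⊨FH I i φ = ∀ v → ∼ M i w v → M , v ⊨FH φ
M , w ⊨FH E i φ = All (𝒜 M i w) (AtFH φ) × (∀ v → ∼ M i w v → M , v ⊨FH φ)

{-# OPTIONS --safe #-}
module Submission where

open import Defs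
open import Data.Nat using (ℕ; suc)
open import Data.Product using (Σ; Σ-syntax; _×_; _,_; proj₁; proj₂)
import Data.Product as Product
import Data.List.Relation.Unary.All as All
open import Relation.Nullary using (¬_)
open import Data.Unit using (⊤; tt)
open import Data.Empty using (⊥)
open import Data.Bool using (Bool; true; false; T)
open import Data.Fin using (zero)
open import Function using (id)
open import Relation.Binary.PropositionalEquality using (_≡_; refl; isEquivalence)

-- L_FH only looks along ∼ᵢ, so FH-truth is invariant under ∼-bisimulations preserving
-- atoms and awareness sets.  [≈]ᵢ is not: when agent i is aware of nothing, ≈ᵢ relates
-- every pair of worlds.  With ∼ᵢ the identity and empty awareness, the single world of a
-- model where every atom holds is bisimilar to the world true of a two-world model whose
-- atoms fail at false, yet [≈]₀ p₀ holds at the former and fails at the latter.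

record Bisimulation {g : ℕ} (M N : Model g) : Set₁ where
  field
    _R_   : W M → W N → Set
    atoms : ∀ {w v} → w R v → ∀ p → V M p w ⇔ V N p v
    aware : ∀ {w v} → w R v → ∀ i p → 𝒜 M i w p ⇔ 𝒜 N i v p
    forth : ∀ {w v w′} i → w R v → ∼ M i w w′ → Σ[ v′ ∈ W N ] (∼ N i v v′ × w′ R v′)
    back  : ∀ {w v v′} i → w R v → ∼ N i v v′ → Σ[ w′ ∈ W M ] (∼ M i w w′ × w′ R v′)

module _ {g : ℕ} {M N : Model g} (B : Bisimulation M N) where
  open Bisimulation B

  □∼-invariant : ∀ i {P : W M → Set} {Q : W N → Set} →
                 (∀ {w v} → w R v → P w ⇔ Q v) →
                 ∀ {w v} → w R v →
                 (∀ w′ → ∼ M i w w′ → P w′) ⇔ (∀ v′ → ∼ N i v v′ → Q v′)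
  □∼-invariant i P⇔Q wRv =
      (λ □P v′ v∼v′ → let (w′ , w∼w′ , w′Rv′) = back i wRv v∼v′
                      in proj₁ (P⇔Q w′Rv′) (□P w′ w∼w′))
    , (λ □Q w′ w∼w′ → let (v′ , v∼v′ , w′Rv′) = forth i wRv w∼w′
                      in proj₂ (P⇔Q w′Rv′) (□Q v′ v∼v′))

  ⊨FH-invariant : ∀ {w v} → w R v → ∀ χ → (M , w ⊨FH χ) ⇔ (N , v ⊨FH χ)
  ⊨FH-invariant wRv (atom p) = atoms wRv p
  ⊨FH-invariant wRv (¬' χ) =
    let (to , from) = ⊨FH-invariant wRv χ
    in (λ ¬φ φ → ¬φ (from φ)) , (λ ¬φ φ → ¬φ (to φ))
  ⊨FH-invariant wRv (χ ∧' ξ) =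
    let (χ-to , χ-from) = ⊨FH-invariant wRv χ
        (ξ-to , ξ-from) = ⊨FH-invariant wRv ξ
    in Product.map χ-to ξ-to , Product.map χ-from ξ-from
  ⊨FH-invariant wRv (A i χ) = All.map (proj₁ (aware wRv i _)) , All.map (proj₂ (aware wRv i _))
  ⊨FH-invariant wRv (I i χ) = □∼-invariant i (λ w′Rv′ → ⊨FH-invariant w′Rv′ χ) wRv
  ⊨FH-invariant wRv (E i χ) =
    let (A-to , A-from) = ⊨FH-invariant wRv (A i χ)
        (I-to , I-from) = □∼-invariant i (λ w′Rv′ → ⊨FH-invariant w′Rv′ χ) wRv
    in Product.map A-to I-to , Product.map A-from I-from

unawareDiscrete : ∀ {g} (X : Set) → X → (Atom → X → Set) → Model g
unawareDiscrete X x val = record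
  { W = X ; nonempty = x ; ∼ = λ _ → _≡_ ; ∼-equiv = λ _ → isEquivalence
  ; 𝒜 = λ _ _ _ → ⊥ ; 𝒜-∼ = λ _ _ _ _ _ → id , id
  ; V = val }

≈-unawareDiscrete : ∀ {g} X x val i (w v : X) → ≈ (unawareDiscrete {g} X x val) i w v
≈-unawareDiscrete _ _ _ _ _ _ = (λ _ → id , id) , (λ _ ())

module _ {g : ℕ} {X Y : Set} {x : X} {y : Y} {valX : Atom → X → Set} {valY : Atom → Y → Set} where

  atomAgreement-bisimulation : Bisimulation (unawareDiscrete {g} X x valX) (unawareDiscrete Y y valY)
  atomAgreement-bisimulation = record
    { _R_   = λ w v → ∀ p → valX p w ⇔ valY p v
    ; atoms = id
    ; aware = λ _ _ _ → id , id
    ; forth = λ { _ wRv refl → _ , refl , wRv }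
    ; back  = λ { _ wRv refl → _ , refl , wRv }
    }

allTrue : ∀ {g} → Model g
allTrue = unawareDiscrete ⊤ tt (λ _ _ → ⊤)

boolValued : ∀ {g} → Model g
boolValued = unawareDiscrete Bool true (λ _ b → T b)

lemma4 : (n : ℕ) → Σ (FormAIL (suc n)) (λ ψ → ¬ Σ (FormFH (suc n)) (λ χ →
    (M : Model (suc n)) (w : W M) → (M , w ⊨AIL ψ) ⇔ (M , w ⊨FH χ)))
lemma4 n = ψ , λ (χ , ψ⇔χ) →
  let χ-allTrue : allTrue , tt ⊨FH χ
      χ-allTrue = proj₁ (ψ⇔χ allTrue tt) (λ _ _ → tt)
      χ-boolValued : boolValued , true ⊨FH χ
      χ-boolValued = proj₁ (⊨FH-invariant atomAgreement-bisimulation (λ _ → id , id) χ) χ-allTrue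
  in proj₂ (ψ⇔χ boolValued true) χ-boolValued false true≈false
  where
  ψ : FormAIL (suc n)
  ψ = [≈] zero (atom 0)

  true≈false : ≈ (boolValued {suc n}) zero true false
  true≈false = ≈-unawareDiscrete {suc n} Bool true (λ _ b → T b) zero true false
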